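{- Let $r\ge1$, $s_1,\ldots,s_r\in\mathbb{N}$, $w=y_{s_1}\cdots y_{s_r}$ and $\mathbf{s}:=(s_1,\ldots,s_{r-1};s_r)$. Then $$\mathrm{Li}^-_w=\sum_{\mathbf{k}}\binom{\mathbf{s}}{\mathbf{k}}\,\mathrm{Li}^-_{\pi(M^{(\mathbf{k})}x_1)},$$ where $\mathbf{k}$ runs over all tuples $(k_1,\ldots,k_d;k_\infty)$ with $d\ge0$ and entries in $\mathbb{N}$ (only finitely many terms are nonzero).
   Context: $\mathbb{N}$ is the set of non-negative integers. An index $\mathbf{k}=(k_1,\ldots,k_d;k_\infty)$ ($d\ge0$, entries in $\mathbb{N}$) has depth $d$ and weight $|\mathbf{k}|=k_1+\cdots+k_d+k_\infty$. For indices $\mathbf{s}=(s_1,\ldots,s_d;s_\infty)$ and $\mathbf{k}$, the array binomial coefficient is $\binom{\mathbf{s}}{\mathbf{k}}:=\prod_{j=1}^{d}\binom{s_1+\cdots+s_j-k_1-\cdots-k_{j-1}}{k_j}$ (empty product $=1$) if $\mathbf{k}$ has the same depth $d$ as $\mathbf{s}$, $|\mathbf{s}|=|\mathbf{k}|$, and $\sum_{i=1}^n(s_i-k_i)\ge0$ for $n=1,\ldots,d$; otherwise it is $0$. For $\mathbf{t}=(t_1,\ldots,t_m)\in\mathbb{N}^m$ put $\mathrm{Li}^-_{\mathbf{t}}(z):=\sum_{n_1>\cdots>n_m>0}n_1^{t_1}\cdots n_m^{t_m}z^{n_1}$ for $|z|<1$ (empty index gives $1$), a rational function in $\mathbb{C}[z,(1-z)^{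 -1}]$. Let $\mathbb{C}\langle Y\rangle$ be the free associative $\mathbb{C}$-algebra on $Y=\{y_0,y_1,\ldots\}$ and $\mathrm{Li}^-_\bullet:\mathbb{C}\langle Y\rangle\to\mathbb{C}[z,(1-z)^{ -1}]$ the $\mathbb{C}$-linear map with $y_{t_1}\cdots y_{t_m}\mapsto\mathrm{Li}^-_{(t_1,\ldots,t_m)}$. Let $\pi:\mathbb{C}\langle x_0,x_1\rangle x_1\to\mathbb{C}\langle Y\rangle$ be the linear isomorphism from the span of words in $x_0,x_1$ ending in $x_1$, $x_0^{t_1}x_1\cdots x_0^{t_m}x_1\mapsto y_{t_1}\cdots y_{t_m}$. Define $x_1^{(0)}:=x_1$, $x_1^{(m)}:=x_0x_1^{(m-1)}-x_1^{(m-1)}x_0$, and $M^{(k_1,\ldots,k_d;k_\infty)}:=x_1^{(k_1)}\cdots x_1^{(k_d)}x_0^{k_\infty}$. -}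

module Defs where

open import Data.Nat as ℕ using (ℕ; zero; suc; _^_; _≤ᵇ_; _≡ᵇ_; _∸_)
open import Data.Nat.Combinatorics using (_C_)
open import Data.Integer as ℤ using (ℤ; +_; -_)
open import Data.Bool using (Bool; true; false; if_then_else_; _∧_)
open import Data.List using (List; []; _∷_; _++_; map; concatMap; upTo; foldr; [_])
open import Data.Product using (_×_; _,_; proj₁; proj₂)

sumℤ : List ℤ → ℤ
sumℤ = foldr ℤ._+_ (+ 0)

-- Li⁻_t as a power series: liCoeff t n is the coefficient of z^n in
--   Li⁻_t(z) = Σ_{n₁>⋯>n_m>0} n₁^{t₁}⋯n_m^{t_m} z^{n₁},
-- i.e. liCoeff (t₁ ∷ … ∷ t_m) n = Σ_{n=n₁>n₂>⋯>n_m>0} n₁^{t₁}⋯n_m^{t_m},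
-- and liCoeff [] n = [n = 0]  (Li⁻_∅ = 1).

liCoeff : List ℕ → ℕ → ℤ
liCoeff []       n = if n ≡ᵇ 0 then + 1 else + 0
liCoeff (t ∷ ts) n = + (n ^ t) ℤ.* sumℤ (map (liCoeff ts) (upTo n))

-- Noncommutative polynomials in x₀ , x₁ with integer coefficients,
-- as formal ℤ-linear combinations of words.
-- Letter false = x₀, true = x₁.

Word : Set
Word = List Bool

NCPoly : Set
NCPoly = List (ℤ × Word)

x₀ x₁ : NCPoly
x₀ = [ (+ 1 , [ false ]) ]
x₁ = [ (+ 1 , [ true ]) ]

_·_ : NCPoly → NCPoly → NCPoly
p · q = concatMap (λ a → map (λ b → (proj₁ a ℤ.* proj₁ b , proj₂ a ++ proj₂ b)) q) p

_−_ : NCPoly → NCPoly → NCPoly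
p − q = p ++ map (λ b → (- proj₁ b , proj₂ b)) q

one : NCPoly
one = [ (+ 1 , []) ]

x₀^ : ℕ → NCPoly
x₀^ zero    = one
x₀^ (suc m) = x₀ · x₀^ m

x₁⁽_⁾ : ℕ → NCPoly
x₁⁽ zero ⁾  = x₁
x₁⁽ suc m ⁾ = (x₀ · x₁⁽ m ⁾) − (x₁⁽ m ⁾ · x₀)

-- Indices 𝐤 = (k₁,…,k_d ; k_∞) : a list (k₁,…,k_d) and k_∞.

Index : Set
Index = List ℕ × ℕ

sumℕ : List ℕ → ℕ
sumℕ = foldr ℕ._+_ 0

weight : Index → ℕ
weight (ks , k∞) = sumℕ ks ℕ.+ k∞

M : Index → NCPoly
M (ks , k∞) = foldr (λ k p → x₁⁽ k ⁾ · p) one ks · x₀^ k∞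

-- π : x₀^{t₁}x₁ ⋯ x₀^{t_m}x₁ ↦ y_{t₁}⋯y_{t_m}, a word in Y being a list
-- of subscripts.  (Only applied to words ending in x₁; trailing x₀'s,
-- which never occur there, would be dropped.)

πw : ℕ → Word → List ℕ
πw c []           = []
πw c (false ∷ w)  = πw (suc c) w
πw c (true ∷ w)   = c ∷ πw 0 w

liPolyCoeff : NCPoly → ℕ → ℤ
liPolyCoeff p n = sumℤ (map (λ a → proj₁ a ℤ.* liCoeff (πw 0 (proj₂ a)) n) p)

-- Array binomial coefficient (s over k), exactly as in the paper:
-- ∏_j C(s₁+⋯+s_j − k₁−⋯−k_{j-1}, k_j) if same depth, equal weight, and
-- all partial sums Σ_{i≤n}(s_i − k_i) ≥ 0; otherwise 0.
-- Accumulators: S = s₁+⋯+s_{j-1}, K = k₁+⋯+k_{j-1}.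

binomGo : List ℕ → List ℕ → ℕ → ℕ → ℕ
binomGo []       []       S K = 1
binomGo []       (_ ∷ _)  S K = 0
binomGo (_ ∷ _)  []       S K = 0
binomGo (s ∷ ss) (k ∷ ks) S K =
  if (K ℕ.+ k) ≤ᵇ (S ℕ.+ s)
  then ((S ℕ.+ s ∸ K) C k) ℕ.* binomGo ss ks (S ℕ.+ s) (K ℕ.+ k)
  else 0

arrayBinom : Index → Index → ℕ
arrayBinom (ss , s∞) (ks , k∞) =
  if weight (ss , s∞) ≡ᵇ weight (ks , k∞) then binomGo ss ks 0 0 else 0

-- Enumeration of all indices of depth ≤ D with every entry ≤ W
-- (a finite box that contains every index of depth ≤ D and weight ≤ W).

box : ℕ → ℕ → List (List ℕ)
box zero    W = [ [] ]
box (suc d) W = concatMap (λ k → map (k ∷_) (box d W)) (upTo (suc W))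

indicesUpTo : ℕ → ℕ → List Index
indicesUpTo D W =
  concatMap (λ d → concatMap (λ ks → map (ks ,_) (upTo (suc W))) (box d W))
            (upTo (suc D))

{-# OPTIONS --safe #-}

-- Work with the coefficient of zⁿ.  There x₀ = z d/dz multiplies by n and x₁, multiplication
-- by z/(1−z), takes strict partial sums; so x₁⁽ᵏ⁾ = [x₀ , x₁⁽ᵏ⁻¹⁾] acts as the convolution
-- g ↦ Σ_{m<n} (n−m)ᵏ g(m), and Li⁻_{π(p x₁)} is p applied to the coefficients of z/(1−z).
-- The coefficient of Li⁻_w is nˢ¹ Σ_{m<n} mˢ² Σ ⋯.  Expanding n^{c+s₁} = ((n−m) + m)^{c+s₁}
-- by the binomial theorem turns n^{c+s₁} Σ_{m<n} into Σ_k C(c+s₁,k) x₁⁽ᵏ⁾ m^{c+s₁−k}, and the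
-- leftover power of m is carried into the next factor.  Induction on the depth produces the
-- products of binomial coefficients of the array binomial, the final carry being k_∞.

module Submission where

open import Defs
open import Data.Nat as ℕ using (ℕ; zero; suc; _≤_; _<_; z≤n; s≤s; _∸_)
import Data.Nat.Properties as ℕP
open import Data.Nat.Combinatorics using (_C_; k>n⇒nCk≡0)
open import Data.Integer as ℤ using (ℤ; +_; -_; _*_; _+_; _-_; _^_)
import Data.Integer.Properties as ℤP
open import Data.Fin using (Fin; toℕ)
open import Data.List using (List; []; _∷_; length; map; _++_; [_]; concatMap; applyUpTo; upTo; foldr)
open import Data.List.Properties using (map-applyUpTo; map-upTo)
open import Function using (_∘_)
open import Data.Product using (_,_; proj₁; proj₂)
open import Data.Bool using (true; false; if_then_else_)
open import Data.Bool.Properties using (if-eta)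
open import Data.Integer.Tactic.RingSolver using (solve-∀)
open import Relation.Binary.PropositionalEquality
  using (_≡_; _≢_; refl; sym; trans; cong; cong₂; subst; module ≡-Reasoning)
open import Relation.Nullary using (¬_; yes; no; contradiction)
open import Relation.Nullary.Reflects using (Reflects; ofʸ; ofⁿ; fromEquivalence)
open import Algebra.Properties.CommutativeSemigroup ℤP.+-commutativeSemigroup using (interchange)
open import Algebra.Properties.CommutativeSemigroup ℤP.*-commutativeSemigroup using (x∙yz≈y∙xz)
import Algebra.Properties.CommutativeSemiring.Binomial ℤP.+-*-commutativeSemiring as Binomial
import Algebra.Properties.Semiring.Exp ℤP.+-*-semiring as SemiringExp
import Algebra.Properties.Monoid.Sum ℤP.+-0-monoid as FinSum
open import Algebra.Definitions.RawMonoid ℤ.+-0-rawMonoid using (_×_)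

private variable A B : Set

∑ : List A → (A → ℤ) → ℤ
∑ xs f = sumℤ (map f xs)

syntax ∑ xs (λ x → e) = ∑[ x ∈ xs ] e

∑-cong : (xs : List A) {f g : A → ℤ} → (∀ x → f x ≡ g x) → ∑ xs f ≡ ∑ xs g
∑-cong []       f≗g = refl
∑-cong (x ∷ xs) f≗g = cong₂ _+_ (f≗g x) (∑-cong xs f≗g)

∑-zero : (xs : List A) {f : A → ℤ} → (∀ x → f x ≡ + 0) → ∑ xs f ≡ + 0
∑-zero []       f≗0 = refl
∑-zero (x ∷ xs) f≗0 = cong₂ _+_ (f≗0 x) (∑-zero xs f≗0)

∑-++ : (xs ys : List A) (f : A → ℤ) → ∑ (xs ++ ys) f ≡ ∑ xs f + ∑ ys f
∑-++ []       ys f = sym (ℤP.+-identityˡ _)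
∑-++ (x ∷ xs) ys f = trans (cong (λ s → f x + s) (∑-++ xs ys f)) (sym (ℤP.+-assoc (f x) _ _))

∑-map : (xs : List A) (g : A → B) (f : B → ℤ) → ∑ (map g xs) f ≡ ∑ xs (f ∘ g)
∑-map []       g f = refl
∑-map (x ∷ xs) g f = cong (λ s → f (g x) + s) (∑-map xs g f)

∑-concatMap : (xs : List A) (g : A → List B) (f : B → ℤ) →
              ∑ (concatMap g xs) f ≡ ∑[ x ∈ xs ] ∑ (g x) f
∑-concatMap []       g f = refl
∑-concatMap (x ∷ xs) g f =
  trans (∑-++ (g x) (concatMap g xs) f) (cong (λ s → ∑ (g x) f + s) (∑-concatMap xs g f))

∑-distrib-+ : (xs : List A) (f g : A → ℤ) → ∑[ x ∈ xs ] (f x + g x) ≡ ∑ xs f + ∑ xs g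
∑-distrib-+ []       f g = refl
∑-distrib-+ (x ∷ xs) f g =
  trans (cong (λ s → f x + g x + s) (∑-distrib-+ xs f g)) (interchange (f x) (g x) _ _)

*-distribˡ-∑ : (c : ℤ) (xs : List A) (f : A → ℤ) → c * ∑ xs f ≡ ∑[ x ∈ xs ] (c * f x)
*-distribˡ-∑ c []       f = ℤP.*-zeroʳ c
*-distribˡ-∑ c (x ∷ xs) f =
  trans (ℤP.*-distribˡ-+ c (f x) _) (cong (λ s → c * f x + s) (*-distribˡ-∑ c xs f))

*-distribʳ-∑ : (c : ℤ) (xs : List A) (f : A → ℤ) → ∑ xs f * c ≡ ∑[ x ∈ xs ] (f x * c)
*-distribʳ-∑ c xs f = trans (ℤP.*-comm (∑ xs f) c)
  (trans (*-distribˡ-∑ c xs f) (∑-cong xs (λ x → ℤP.*-comm c (f x))))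

neg-distrib-∑ : (xs : List A) (f : A → ℤ) → - ∑ xs f ≡ ∑[ x ∈ xs ] (- f x)
neg-distrib-∑ []       f = refl
neg-distrib-∑ (x ∷ xs) f =
  trans (ℤP.neg-distrib-+ (f x) _) (cong (λ s → - f x + s) (neg-distrib-∑ xs f))

∑-comm : (xs : List A) (ys : List B) (f : A → B → ℤ) →
         ∑[ x ∈ xs ] ∑ ys (f x) ≡ ∑[ y ∈ ys ] ∑[ x ∈ xs ] f x y
∑-comm []       ys f = sym (∑-zero ys (λ _ → refl))
∑-comm (x ∷ xs) ys f =
  trans (cong (λ s → ∑ ys (f x) + s) (∑-comm xs ys f)) (sym (∑-distrib-+ ys (f x) _))

∑-upTo-suc : ∀ n (f : ℕ → ℤ) → ∑ (upTo (suc n)) f ≡ f 0 + ∑ (upTo n) (f ∘ suc)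
∑-upTo-suc n f =
  cong (λ xs → f 0 + sumℤ xs) (trans (map-applyUpTo suc f n) (sym (map-upTo (f ∘ suc) n)))

∑-upTo-cong : ∀ n {f g : ℕ → ℤ} → (∀ i → i < n → f i ≡ g i) → ∑ (upTo n) f ≡ ∑ (upTo n) g
∑-upTo-cong zero    f≗g = refl
∑-upTo-cong (suc n) {f} {g} f≗g = begin
  ∑ (upTo (suc n)) f
    ≡⟨ ∑-upTo-suc n f ⟩
  f 0 + ∑ (upTo n) (f ∘ suc)
    ≡⟨ cong₂ _+_ (f≗g 0 (s≤s z≤n)) (∑-upTo-cong n (λ i → f≗g (suc i) ∘ s≤s)) ⟩
  g 0 + ∑ (upTo n) (g ∘ suc)
    ≡⟨ sym (∑-upTo-suc n g) ⟩
  ∑ (upTo (suc n)) g ∎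
  where open ≡-Reasoning

∑-upTo-point : ∀ {N e} (f : ℕ → ℤ) → e < N → (∀ i → i ≢ e → f i ≡ + 0) → ∑ (upTo N) f ≡ f e
∑-upTo-point {suc N} {zero} f _ f≗0 = begin
  ∑ (upTo (suc N)) f         ≡⟨ ∑-upTo-suc N f ⟩
  f 0 + ∑ (upTo N) (f ∘ suc) ≡⟨ cong (λ s → f 0 + s) (∑-zero (upTo N) (λ i → f≗0 (suc i) λ ())) ⟩
  f 0 + + 0                  ≡⟨ ℤP.+-identityʳ (f 0) ⟩
  f 0                        ∎
  where open ≡-Reasoning
∑-upTo-point {suc N} {suc e} f (s≤s e<N) f≗0 = begin
  ∑ (upTo (suc N)) f
    ≡⟨ ∑-upTo-suc N f ⟩
  f 0 + ∑ (upTo N) (f ∘ suc)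
    ≡⟨ cong₂ _+_ (f≗0 0 λ ()) (∑-upTo-point (f ∘ suc) e<N (λ i i≢e → f≗0 (suc i) (i≢e ∘ ℕP.suc-injective))) ⟩
  + 0 + f (suc e)
    ≡⟨ ℤP.+-identityˡ (f (suc e)) ⟩
  f (suc e) ∎
  where open ≡-Reasoning

∑-upTo-extend : ∀ {M N} (f : ℕ → ℤ) → M ≤ N → (∀ i → M ≤ i → f i ≡ + 0) →
                ∑ (upTo N) f ≡ ∑ (upTo M) f
∑-upTo-extend {zero}  {N}     f _         f≗0 = ∑-zero (upTo N) (λ i → f≗0 i z≤n)
∑-upTo-extend {suc M} {suc N} f (s≤s M≤N) f≗0 = begin
  ∑ (upTo (suc N)) f
    ≡⟨ ∑-upTo-suc N f ⟩
  f 0 + ∑ (upTo N) (f ∘ suc)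
    ≡⟨ cong (λ s → f 0 + s) (∑-upTo-extend (f ∘ suc) M≤N (λ i → f≗0 (suc i) ∘ s≤s)) ⟩
  f 0 + ∑ (upTo M) (f ∘ suc)
    ≡⟨ sym (∑-upTo-suc M f) ⟩
  ∑ (upTo (suc M)) f ∎
  where open ≡-Reasoning

∑-upTo≡sum : ∀ N (f : ℕ → ℤ) → ∑ (upTo N) f ≡ FinSum.sum (λ (i : Fin N) → f (toℕ i))
∑-upTo≡sum N f = trans (cong sumℤ (map-upTo f N)) (sumℤ-applyUpTo N f)
  where
  sumℤ-applyUpTo : ∀ N (f : ℕ → ℤ) → sumℤ (applyUpTo f N) ≡ FinSum.sum (λ (i : Fin N) → f (toℕ i))
  sumℤ-applyUpTo zero    f = refl
  sumℤ-applyUpTo (suc N) f = cong (λ s → f 0 + s) (sumℤ-applyUpTo N (f ∘ suc))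

×≡* : ∀ k x → k × x ≡ + k * x
×≡* zero    x = refl
×≡* (suc k) x = begin
  x + k × x         ≡⟨ cong (λ s → x + s) (×≡* k x) ⟩
  x + + k * x       ≡⟨ cong (_+ + k * x) (sym (ℤP.*-identityˡ x)) ⟩
  + 1 * x + + k * x ≡⟨ sym (ℤP.*-distribʳ-+ x (+ 1) (+ k)) ⟩
  + suc k * x       ∎
  where open ≡-Reasoning

^≡^ : ∀ x k → x ^ k ≡ x SemiringExp.^ k
^≡^ x zero    = refl
^≡^ x (suc k) = cong (x *_) (^≡^ x k)

binomial : ∀ {a N} X Y → a < N → (X + Y) ^ a ≡ ∑[ j ∈ upTo N ] (+ (a C j) * (X ^ j * Y ^ (a ∸ j)))
binomial {a} {N} X Y a<N = begin
  (X + Y) ^ a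
    ≡⟨ ^≡^ (X + Y) a ⟩
  (X + Y) SemiringExp.^ a
    ≡⟨ Binomial.theorem a X Y ⟩
  Binomial.binomialExpansion X Y a
    ≡⟨ FinSum.sum-cong-≗ {suc a} (λ j → term-agrees (toℕ j)) ⟩
  FinSum.sum (λ (j : Fin (suc a)) → term (toℕ j))
    ≡⟨ sym (∑-upTo≡sum (suc a) term) ⟩
  ∑ (upTo (suc a)) term
    ≡⟨ sym (∑-upTo-extend term a<N vanishes) ⟩
  ∑ (upTo N) term ∎
  where
  open ≡-Reasoning
  term : ℕ → ℤ
  term j = + (a C j) * (X ^ j * Y ^ (a ∸ j))
  term-agrees : ∀ j → (a C j) × (X SemiringExp.^ j * Y SemiringExp.^ (a ∸ j)) ≡ term j
  term-agrees j rewrite sym (^≡^ X j) | sym (^≡^ Y (a ∸ j)) = ×≡* (a C j) _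
  vanishes : ∀ j → suc a ≤ j → term j ≡ + 0
  vanishes j a<j rewrite k>n⇒nCk≡0 a<j = refl

C-guard : ∀ a j {x y : ℤ} → (j ≤ a → x ≡ y) → + (a C j) * x ≡ + (a C j) * y
C-guard a j x≡y with j ℕP.≤? a
... | yes j≤a = cong (+ (a C j) *_) (x≡y j≤a)
... | no  j≰a rewrite k>n⇒nCk≡0 (ℕP.≰⇒> j≰a) = refl

-- Coefficient sequences and the action of words

Seq : Set
Seq = ℕ → ℤ

δ₀ : Seq
δ₀ = liCoeff []

sumBelow : Seq → Seq
sumBelow g n = ∑[ m ∈ upTo n ] g m

mulPow : ℕ → Seq → Seq
mulPow a g n = + (n ℕ.^ a) * g n

convPow : ℕ → Seq → Seq
convPow k g n = ∑[ m ∈ upTo n ] ((+ (n ∸ m)) ^ k * g m)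

convPows : List ℕ → Seq → Seq
convPows ks g = foldr convPow g ks

pos-^ : ∀ m a → + (m ℕ.^ a) ≡ (+ m) ^ a
pos-^ m zero    = refl
pos-^ m (suc a) = trans (ℤP.pos-* m (m ℕ.^ a)) (cong (+ m *_) (pos-^ m a))

pos-∸-+ : ∀ {m n} → m ≤ n → + (n ∸ m) + + m ≡ + n
pos-∸-+ {m} {n} m≤n = trans (sym (ℤP.pos-+ (n ∸ m) m)) (cong +_ (ℕP.m∸n+n≡m m≤n))

mulPow-+ : ∀ a b g n → mulPow a (mulPow b g) n ≡ mulPow (a ℕ.+ b) g n
mulPow-+ a b g n = begin
  + (n ℕ.^ a) * (+ (n ℕ.^ b) * g n)   ≡⟨ sym (ℤP.*-assoc (+ (n ℕ.^ a)) _ (g n)) ⟩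
  + (n ℕ.^ a) * + (n ℕ.^ b) * g n     ≡⟨ cong (_* g n) (sym (ℤP.pos-* (n ℕ.^ a) _)) ⟩
  + (n ℕ.^ a ℕ.* n ℕ.^ b) * g n       ≡⟨ cong (λ e → + e * g n) (sym (ℕP.^-distribˡ-+-* n a b)) ⟩
  + (n ℕ.^ (a ℕ.+ b)) * g n           ∎
  where open ≡-Reasoning

convPow-cong : ∀ k {f g : Seq} → (∀ m → f m ≡ g m) → ∀ n → convPow k f n ≡ convPow k g n
convPow-cong k f≗g n = ∑-cong (upTo n) (λ m → cong ((+ (n ∸ m)) ^ k *_) (f≗g m))

convPows-cong : ∀ ks {f g : Seq} → (∀ m → f m ≡ g m) → ∀ n → convPows ks f n ≡ convPows ks g n
convPows-cong []       f≗g = f≗g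
convPows-cong (k ∷ ks) f≗g = convPow-cong k (convPows-cong ks f≗g)

convPow-scalar : ∀ k c f n → convPow k (λ m → c * f m) n ≡ c * convPow k f n
convPow-scalar k c f n = begin
  ∑[ m ∈ upTo n ] ((+ (n ∸ m)) ^ k * (c * f m))
    ≡⟨ ∑-cong (upTo n) (λ m → x∙yz≈y∙xz ((+ (n ∸ m)) ^ k) c (f m)) ⟩
  ∑[ m ∈ upTo n ] (c * ((+ (n ∸ m)) ^ k * f m))
    ≡⟨ sym (*-distribˡ-∑ c (upTo n) _) ⟩
  c * convPow k f n ∎
  where open ≡-Reasoning

convPow-∑ : ∀ k (xs : List A) (F : A → Seq) n →
  convPow k (λ m → ∑[ x ∈ xs ] F x m) n ≡ ∑[ x ∈ xs ] convPow k (F x) n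
convPow-∑ k xs F n = begin
  ∑[ m ∈ upTo n ] ((+ (n ∸ m)) ^ k * ∑[ x ∈ xs ] F x m)
    ≡⟨ ∑-cong (upTo n) (λ m → *-distribˡ-∑ ((+ (n ∸ m)) ^ k) xs _) ⟩
  ∑[ m ∈ upTo n ] ∑[ x ∈ xs ] ((+ (n ∸ m)) ^ k * F x m)
    ≡⟨ ∑-comm (upTo n) xs _ ⟩
  ∑[ x ∈ xs ] convPow k (F x) n ∎
  where open ≡-Reasoning

mulPow-sumBelow : ∀ {a N} → a < N → ∀ g n →
  mulPow a (sumBelow g) n ≡ ∑[ j ∈ upTo N ] (+ (a C j) * convPow j (mulPow (a ∸ j) g) n)
mulPow-sumBelow {a} {N} a<N g n = begin
  + (n ℕ.^ a) * ∑[ m ∈ upTo n ] g m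
    ≡⟨ *-distribˡ-∑ (+ (n ℕ.^ a)) (upTo n) g ⟩
  ∑[ m ∈ upTo n ] (+ (n ℕ.^ a) * g m)
    ≡⟨ ∑-upTo-cong n expand ⟩
  ∑[ m ∈ upTo n ] ∑[ j ∈ upTo N ] term j m
    ≡⟨ ∑-comm (upTo n) (upTo N) (λ m j → term j m) ⟩
  ∑[ j ∈ upTo N ] ∑[ m ∈ upTo n ] term j m
    ≡⟨ ∑-cong (upTo N) (λ j → sym (*-distribˡ-∑ (+ (a C j)) (upTo n) _)) ⟩
  ∑[ j ∈ upTo N ] (+ (a C j) * convPow j (mulPow (a ∸ j) g) n) ∎
  where
  open ≡-Reasoning
  term : ℕ → ℕ → ℤ
  term j m = + (a C j) * ((+ (n ∸ m)) ^ j * mulPow (a ∸ j) g m)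
  regroup : ∀ c x y f → c * (x * y) * f ≡ c * (x * (y * f))
  regroup = solve-∀
  absorb : ∀ m j → + (a C j) * ((+ (n ∸ m)) ^ j * (+ m) ^ (a ∸ j)) * g m ≡ term j m
  absorb m j = begin
    + (a C j) * ((+ (n ∸ m)) ^ j * (+ m) ^ (a ∸ j)) * g m
      ≡⟨ regroup (+ (a C j)) ((+ (n ∸ m)) ^ j) ((+ m) ^ (a ∸ j)) (g m) ⟩
    + (a C j) * ((+ (n ∸ m)) ^ j * ((+ m) ^ (a ∸ j) * g m))
      ≡⟨ cong (λ y → + (a C j) * ((+ (n ∸ m)) ^ j * (y * g m))) (sym (pos-^ m (a ∸ j))) ⟩
    term j m ∎
  expand : ∀ m → m < n → + (n ℕ.^ a) * g m ≡ ∑[ j ∈ upTo N ] term j m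
  expand m m<n = begin
    + (n ℕ.^ a) * g m
      ≡⟨ cong (_* g m) (pos-^ n a) ⟩
    (+ n) ^ a * g m
      ≡⟨ cong (λ x → x ^ a * g m) (sym (pos-∸-+ (ℕP.<⇒≤ m<n))) ⟩
    (+ (n ∸ m) + + m) ^ a * g m
      ≡⟨ cong (_* g m) (binomial (+ (n ∸ m)) (+ m) a<N) ⟩
    ∑[ j ∈ upTo N ] (+ (a C j) * ((+ (n ∸ m)) ^ j * (+ m) ^ (a ∸ j))) * g m
      ≡⟨ *-distribʳ-∑ (g m) (upTo N) _ ⟩
    ∑[ j ∈ upTo N ] (+ (a C j) * ((+ (n ∸ m)) ^ j * (+ m) ^ (a ∸ j)) * g m)
      ≡⟨ ∑-cong (upTo N) (absorb m) ⟩
    ∑[ j ∈ upTo N ] term j m ∎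

⟦_⟧ʷ : Word → Seq → Seq
⟦ []        ⟧ʷ g   = g
⟦ false ∷ w ⟧ʷ g n = + n * ⟦ w ⟧ʷ g n
⟦ true ∷ w  ⟧ʷ g   = sumBelow (⟦ w ⟧ʷ g)

⟦_⟧ : NCPoly → Seq → Seq
⟦ p ⟧ g n = ∑[ a ∈ p ] (proj₁ a * ⟦ proj₂ a ⟧ʷ g n)

liCoeff-πw : ∀ w c n → liCoeff (πw c (w ++ [ true ])) n ≡ mulPow c (⟦ w ⟧ʷ (sumBelow δ₀)) n
liCoeff-πw []          c n = refl
liCoeff-πw (false ∷ w) c n = begin
  liCoeff (πw (suc c) (w ++ [ true ])) n
    ≡⟨ liCoeff-πw w (suc c) n ⟩
  + (n ℕ.* n ℕ.^ c) * ⟦ w ⟧ʷ (sumBelow δ₀) n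
    ≡⟨ cong (_* ⟦ w ⟧ʷ (sumBelow δ₀) n) (ℤP.pos-* n (n ℕ.^ c)) ⟩
  + n * + (n ℕ.^ c) * ⟦ w ⟧ʷ (sumBelow δ₀) n
    ≡⟨ swap (+ n) (+ (n ℕ.^ c)) _ ⟩
  mulPow c (⟦ false ∷ w ⟧ʷ (sumBelow δ₀)) n ∎
  where
  open ≡-Reasoning
  swap : ∀ a b f → a * b * f ≡ b * (a * f)
  swap = solve-∀
liCoeff-πw (true ∷ w)  c n =
  cong (+ (n ℕ.^ c) *_) (∑-cong (upTo n) (λ m → trans (liCoeff-πw w 0 m) (ℤP.*-identityˡ _)))

liPolyCoeff-·x₁ : ∀ p n → liPolyCoeff (p · x₁) n ≡ ⟦ p ⟧ (sumBelow δ₀) n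
liPolyCoeff-·x₁ []            n = refl
liPolyCoeff-·x₁ ((c , w) ∷ p) n = cong₂ _+_ monomial (liPolyCoeff-·x₁ p n)
  where
  monomial : c * + 1 * liCoeff (πw 0 (w ++ [ true ])) n ≡ c * ⟦ w ⟧ʷ (sumBelow δ₀) n
  monomial = cong₂ _*_ (ℤP.*-identityʳ c) (trans (liCoeff-πw w 0 n) (ℤP.*-identityˡ _))

⟦⟧ʷ-cong : ∀ w {f g : Seq} → (∀ m → f m ≡ g m) → ∀ n → ⟦ w ⟧ʷ f n ≡ ⟦ w ⟧ʷ g n
⟦⟧ʷ-cong []          f≗g n = f≗g n
⟦⟧ʷ-cong (false ∷ w) f≗g n = cong (+ n *_) (⟦⟧ʷ-cong w f≗g n)
⟦⟧ʷ-cong (true ∷ w)  f≗g n = ∑-cong (upTo n) (⟦⟧ʷ-cong w f≗g)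

⟦⟧-cong : ∀ p {f g : Seq} → (∀ m → f m ≡ g m) → ∀ n → ⟦ p ⟧ f n ≡ ⟦ p ⟧ g n
⟦⟧-cong p f≗g n = ∑-cong p (λ a → cong (proj₁ a *_) (⟦⟧ʷ-cong (proj₂ a) f≗g n))

⟦⟧ʷ-linear : ∀ w (xs : List A) (c : A → ℤ) (F : A → Seq) n →
  ⟦ w ⟧ʷ (λ m → ∑[ x ∈ xs ] (c x * F x m)) n ≡ ∑[ x ∈ xs ] (c x * ⟦ w ⟧ʷ (F x) n)
⟦⟧ʷ-linear []          xs c F n = refl
⟦⟧ʷ-linear (false ∷ w) xs c F n = begin
  + n * ⟦ w ⟧ʷ _ n                              ≡⟨ cong (+ n *_) (⟦⟧ʷ-linear w xs c F n) ⟩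
  + n * ∑[ x ∈ xs ] (c x * ⟦ w ⟧ʷ (F x) n)      ≡⟨ *-distribˡ-∑ (+ n) xs _ ⟩
  ∑[ x ∈ xs ] (+ n * (c x * ⟦ w ⟧ʷ (F x) n))    ≡⟨ ∑-cong xs (λ x → x∙yz≈y∙xz (+ n) (c x) _) ⟩
  ∑[ x ∈ xs ] (c x * (+ n * ⟦ w ⟧ʷ (F x) n))    ∎
  where open ≡-Reasoning
⟦⟧ʷ-linear (true ∷ w)  xs c F n = begin
  ∑[ m ∈ upTo n ] ⟦ w ⟧ʷ _ m
    ≡⟨ ∑-cong (upTo n) (⟦⟧ʷ-linear w xs c F) ⟩
  ∑[ m ∈ upTo n ] ∑[ x ∈ xs ] (c x * ⟦ w ⟧ʷ (F x) m)
    ≡⟨ ∑-comm (upTo n) xs _ ⟩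
  ∑[ x ∈ xs ] ∑[ m ∈ upTo n ] (c x * ⟦ w ⟧ʷ (F x) m)
    ≡⟨ ∑-cong xs (λ x → sym (*-distribˡ-∑ (c x) (upTo n) _)) ⟩
  ∑[ x ∈ xs ] (c x * ⟦ true ∷ w ⟧ʷ (F x) n) ∎
  where open ≡-Reasoning

⟦⟧ʷ-++ : ∀ u v g n → ⟦ u ++ v ⟧ʷ g n ≡ ⟦ u ⟧ʷ (⟦ v ⟧ʷ g) n
⟦⟧ʷ-++ []          v g n = refl
⟦⟧ʷ-++ (false ∷ u) v g n = cong (+ n *_) (⟦⟧ʷ-++ u v g n)
⟦⟧ʷ-++ (true ∷ u)  v g n = ∑-cong (upTo n) (⟦⟧ʷ-++ u v g)

⟦⟧-· : ∀ p q g n → ⟦ p · q ⟧ g n ≡ ⟦ p ⟧ (⟦ q ⟧ g) n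
⟦⟧-· []            q g n = refl
⟦⟧-· ((c , w) ∷ p) q g n =
  trans (∑-++ (map (λ b → (c * proj₁ b , w ++ proj₂ b)) q) _ _)
        (cong₂ _+_ monomial (⟦⟧-· p q g n))
  where
  open ≡-Reasoning
  monomial : ∑ (map (λ b → (c * proj₁ b , w ++ proj₂ b)) q) (λ a → proj₁ a * ⟦ proj₂ a ⟧ʷ g n)
             ≡ c * ⟦ w ⟧ʷ (⟦ q ⟧ g) n
  monomial = begin
    _
      ≡⟨ ∑-map q _ _ ⟩
    ∑[ b ∈ q ] (c * proj₁ b * ⟦ w ++ proj₂ b ⟧ʷ g n)
      ≡⟨ ∑-cong q (λ b → cong (c * proj₁ b *_) (⟦⟧ʷ-++ w (proj₂ b) g n)) ⟩
    ∑[ b ∈ q ] (c * proj₁ b * ⟦ w ⟧ʷ (⟦ proj₂ b ⟧ʷ g) n)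
      ≡⟨ ∑-cong q (λ b → ℤP.*-assoc c (proj₁ b) _) ⟩
    ∑[ b ∈ q ] (c * (proj₁ b * ⟦ w ⟧ʷ (⟦ proj₂ b ⟧ʷ g) n))
      ≡⟨ sym (*-distribˡ-∑ c q _) ⟩
    c * ∑[ b ∈ q ] (proj₁ b * ⟦ w ⟧ʷ (⟦ proj₂ b ⟧ʷ g) n)
      ≡⟨ cong (c *_) (sym (⟦⟧ʷ-linear w q proj₁ (λ b → ⟦ proj₂ b ⟧ʷ g) n)) ⟩
    c * ⟦ w ⟧ʷ (⟦ q ⟧ g) n ∎

⟦⟧-− : ∀ p q g n → ⟦ p − q ⟧ g n ≡ ⟦ p ⟧ g n - ⟦ q ⟧ g n
⟦⟧-− p q g n = begin
  ⟦ p − q ⟧ g n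
    ≡⟨ ∑-++ p _ _ ⟩
  ⟦ p ⟧ g n + ∑ (map (λ b → (- proj₁ b , proj₂ b)) q) _
    ≡⟨ cong (λ s → ⟦ p ⟧ g n + s) (∑-map q _ _) ⟩
  ⟦ p ⟧ g n + ∑[ b ∈ q ] (- proj₁ b * ⟦ proj₂ b ⟧ʷ g n)
    ≡⟨ cong (λ s → ⟦ p ⟧ g n + s) (∑-cong q (λ b → sym (ℤP.neg-distribˡ-* (proj₁ b) _))) ⟩
  ⟦ p ⟧ g n + ∑[ b ∈ q ] (- (proj₁ b * ⟦ proj₂ b ⟧ʷ g n))
    ≡⟨ cong (λ s → ⟦ p ⟧ g n + s) (sym (neg-distrib-∑ q _)) ⟩
  ⟦ p ⟧ g n - ⟦ q ⟧ g n ∎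
  where open ≡-Reasoning

⟦one⟧ : ∀ g n → ⟦ one ⟧ g n ≡ g n
⟦one⟧ g n = trans (ℤP.+-identityʳ _) (ℤP.*-identityˡ (g n))

⟦x₀⟧ : ∀ g n → ⟦ x₀ ⟧ g n ≡ + n * g n
⟦x₀⟧ g n = trans (ℤP.+-identityʳ _) (ℤP.*-identityˡ (+ n * g n))

⟦x₀^⟧ : ∀ k g n → ⟦ x₀^ k ⟧ g n ≡ mulPow k g n
⟦x₀^⟧ zero    g n = trans (⟦one⟧ g n) (sym (ℤP.*-identityˡ (g n)))
⟦x₀^⟧ (suc k) g n = begin
  ⟦ x₀ · x₀^ k ⟧ g n            ≡⟨ ⟦⟧-· x₀ (x₀^ k) g n ⟩
  ⟦ x₀ ⟧ (⟦ x₀^ k ⟧ g) n        ≡⟨ ⟦x₀⟧ (⟦ x₀^ k ⟧ g) n ⟩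
  + n * ⟦ x₀^ k ⟧ g n           ≡⟨ cong (+ n *_) (⟦x₀^⟧ k g n) ⟩
  + n * (+ (n ℕ.^ k) * g n)     ≡⟨ sym (ℤP.*-assoc (+ n) _ (g n)) ⟩
  + n * + (n ℕ.^ k) * g n       ≡⟨ cong (_* g n) (sym (ℤP.pos-* n (n ℕ.^ k))) ⟩
  mulPow (suc k) g n            ∎
  where open ≡-Reasoning

convPow-suc : ∀ k g n → + n * convPow k g n - convPow k (λ m → + m * g m) n ≡ convPow (suc k) g n
convPow-suc k g n = begin
  + n * ∑[ m ∈ upTo n ] (P m * g m) - ∑[ m ∈ upTo n ] (P m * (+ m * g m))
    ≡⟨ cong₂ _+_ (*-distribˡ-∑ (+ n) (upTo n) _) (neg-distrib-∑ (upTo n) _) ⟩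
  ∑[ m ∈ upTo n ] (+ n * (P m * g m)) + ∑[ m ∈ upTo n ] (- (P m * (+ m * g m)))
    ≡⟨ sym (∑-distrib-+ (upTo n) _ _) ⟩
  ∑[ m ∈ upTo n ] (+ n * (P m * g m) - P m * (+ m * g m))
    ≡⟨ ∑-upTo-cong n (λ m m<n → cong (λ x → x * (P m * g m) - P m * (+ m * g m)) (sym (pos-∸-+ (ℕP.<⇒≤ m<n)))) ⟩
  ∑[ m ∈ upTo n ] ((+ (n ∸ m) + + m) * (P m * g m) - P m * (+ m * g m))
    ≡⟨ ∑-cong (upTo n) (λ m → cancel (+ (n ∸ m)) (+ m) (P m) (g m)) ⟩
  convPow (suc k) g n ∎
  where
  open ≡-Reasoning
  P : ℕ → ℤ
  P m = (+ (n ∸ m)) ^ k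
  cancel : ∀ d m p x → (d + m) * (p * x) - p * (m * x) ≡ d * p * x
  cancel = solve-∀

⟦x₁⁽⁾⟧ : ∀ k g n → ⟦ x₁⁽ k ⁾ ⟧ g n ≡ convPow k g n
⟦x₁⁽⁾⟧ zero    g n = trans (ℤP.+-identityʳ _)
  (trans (ℤP.*-identityˡ _) (∑-cong (upTo n) (λ m → sym (ℤP.*-identityˡ (g m)))))
⟦x₁⁽⁾⟧ (suc k) g n = begin
  ⟦ (x₀ · x₁⁽ k ⁾) − (x₁⁽ k ⁾ · x₀) ⟧ g n
    ≡⟨ ⟦⟧-− (x₀ · x₁⁽ k ⁾) (x₁⁽ k ⁾ · x₀) g n ⟩
  ⟦ x₀ · x₁⁽ k ⁾ ⟧ g n - ⟦ x₁⁽ k ⁾ · x₀ ⟧ g n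
    ≡⟨ cong₂ _-_ (⟦⟧-· x₀ x₁⁽ k ⁾ g n) (⟦⟧-· x₁⁽ k ⁾ x₀ g n) ⟩
  ⟦ x₀ ⟧ (⟦ x₁⁽ k ⁾ ⟧ g) n - ⟦ x₁⁽ k ⁾ ⟧ (⟦ x₀ ⟧ g) n
    ≡⟨ cong₂ _-_ (⟦x₀⟧ (⟦ x₁⁽ k ⁾ ⟧ g) n) (⟦⟧-cong x₁⁽ k ⁾ (⟦x₀⟧ g) n) ⟩
  + n * ⟦ x₁⁽ k ⁾ ⟧ g n - ⟦ x₁⁽ k ⁾ ⟧ (λ m → + m * g m) n
    ≡⟨ cong₂ _-_ (cong (+ n *_) (⟦x₁⁽⁾⟧ k g n)) (⟦x₁⁽⁾⟧ k _ n) ⟩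
  + n * convPow k g n - convPow k (λ m → + m * g m) n
    ≡⟨ convPow-suc k g n ⟩
  convPow (suc k) g n ∎
  where open ≡-Reasoning

⟦x₁⁽⁾-product⟧ : ∀ ks g n → ⟦ foldr (λ k p → x₁⁽ k ⁾ · p) one ks ⟧ g n ≡ convPows ks g n
⟦x₁⁽⁾-product⟧ []       g n = ⟦one⟧ g n
⟦x₁⁽⁾-product⟧ (k ∷ ks) g n = begin
  ⟦ x₁⁽ k ⁾ · P ⟧ g n           ≡⟨ ⟦⟧-· x₁⁽ k ⁾ P g n ⟩
  ⟦ x₁⁽ k ⁾ ⟧ (⟦ P ⟧ g) n       ≡⟨ ⟦⟧-cong x₁⁽ k ⁾ (⟦x₁⁽⁾-product⟧ ks g) n ⟩
  ⟦ x₁⁽ k ⁾ ⟧ (convPows ks g) n ≡⟨ ⟦x₁⁽⁾⟧ k (convPows ks g) n ⟩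
  convPows (k ∷ ks) g n         ∎
  where
  open ≡-Reasoning
  P : NCPoly
  P = foldr (λ k p → x₁⁽ k ⁾ · p) one ks

liPolyCoeff-M·x₁ : ∀ ks k∞ n → liPolyCoeff (M (ks , k∞) · x₁) n ≡ convPows ks (mulPow k∞ (sumBelow δ₀)) n
liPolyCoeff-M·x₁ ks k∞ n = begin
  liPolyCoeff ((P · x₀^ k∞) · x₁) n        ≡⟨ liPolyCoeff-·x₁ (P · x₀^ k∞) n ⟩
  ⟦ P · x₀^ k∞ ⟧ (sumBelow δ₀) n           ≡⟨ ⟦⟧-· P (x₀^ k∞) (sumBelow δ₀) n ⟩
  ⟦ P ⟧ (⟦ x₀^ k∞ ⟧ (sumBelow δ₀)) n       ≡⟨ ⟦x₁⁽⁾-product⟧ ks _ n ⟩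
  convPows ks (⟦ x₀^ k∞ ⟧ (sumBelow δ₀)) n ≡⟨ convPows-cong ks (⟦x₀^⟧ k∞ (sumBelow δ₀)) n ⟩
  convPows ks (mulPow k∞ (sumBelow δ₀)) n  ∎
  where
  open ≡-Reasoning
  P : NCPoly
  P = foldr (λ k p → x₁⁽ k ⁾ · p) one ks

-- Array binomial coefficients

-- c is the carry s₁+⋯+s_{j−1} − k₁−⋯−k_{j−1}.  The paper's partial-sum condition needs no
-- test: C(c + s, k) = 0 as soon as k > c + s.
carriedBinom : ℕ → List ℕ → List ℕ → ℕ
carriedBinom c []       []       = 1
carriedBinom c []       (_ ∷ _)  = 0
carriedBinom c (_ ∷ _)  []       = 0
carriedBinom c (s ∷ ss) (k ∷ ks) = ((c ℕ.+ s) C k) ℕ.* carriedBinom (c ℕ.+ s ∸ k) ss ks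

binomGo≡carriedBinom : ∀ ss ks K c → binomGo ss ks (K ℕ.+ c) K ≡ carriedBinom c ss ks
binomGo≡carriedBinom []       []       K c = refl
binomGo≡carriedBinom []       (_ ∷ _)  K c = refl
binomGo≡carriedBinom (_ ∷ _)  []       K c = refl
binomGo≡carriedBinom (s ∷ ss) (k ∷ ks) K c
  with K ℕ.+ k ℕ.≤ᵇ K ℕ.+ c ℕ.+ s | ℕP.≤ᵇ-reflects-≤ (K ℕ.+ k) (K ℕ.+ c ℕ.+ s)
... | true  | ofʸ K+k≤K+c+s = begin
  ((K ℕ.+ c ℕ.+ s ∸ K) C k) ℕ.* binomGo ss ks (K ℕ.+ c ℕ.+ s) (K ℕ.+ k)
    ≡⟨ cong₂ (λ a S → (a C k) ℕ.* binomGo ss ks S (K ℕ.+ k)) carry-top carry-next ⟩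
  ((c ℕ.+ s) C k) ℕ.* binomGo ss ks (K ℕ.+ k ℕ.+ (c ℕ.+ s ∸ k)) (K ℕ.+ k)
    ≡⟨ cong (((c ℕ.+ s) C k) ℕ.*_) (binomGo≡carriedBinom ss ks (K ℕ.+ k) (c ℕ.+ s ∸ k)) ⟩
  ((c ℕ.+ s) C k) ℕ.* carriedBinom (c ℕ.+ s ∸ k) ss ks ∎
  where
  open ≡-Reasoning
  k≤c+s : k ≤ c ℕ.+ s
  k≤c+s = ℕP.+-cancelˡ-≤ K k (c ℕ.+ s) (subst (K ℕ.+ k ≤_) (ℕP.+-assoc K c s) K+k≤K+c+s)
  carry-top : K ℕ.+ c ℕ.+ s ∸ K ≡ c ℕ.+ s
  carry-top = trans (cong (_∸ K) (ℕP.+-assoc K c s)) (ℕP.m+n∸m≡n K (c ℕ.+ s))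
  carry-next : K ℕ.+ c ℕ.+ s ≡ K ℕ.+ k ℕ.+ (c ℕ.+ s ∸ k)
  carry-next = begin
    K ℕ.+ c ℕ.+ s               ≡⟨ ℕP.+-assoc K c s ⟩
    K ℕ.+ (c ℕ.+ s)             ≡⟨ cong (K ℕ.+_) (sym (ℕP.m+[n∸m]≡n k≤c+s)) ⟩
    K ℕ.+ (k ℕ.+ (c ℕ.+ s ∸ k)) ≡⟨ sym (ℕP.+-assoc K k _) ⟩
    K ℕ.+ k ℕ.+ (c ℕ.+ s ∸ k)   ∎
... | false | ofⁿ K+k≰K+c+s = sym (cong (ℕ._* carriedBinom (c ℕ.+ s ∸ k) ss ks) (k>n⇒nCk≡0 (ℕP.≰⇒> k≰c+s)))
  where
  k≰c+s : ¬ k ≤ c ℕ.+ s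
  k≰c+s k≤c+s = K+k≰K+c+s (subst (K ℕ.+ k ≤_) (sym (ℕP.+-assoc K c s)) (ℕP.+-monoʳ-≤ K k≤c+s))

carriedBinom-length : ∀ c ss ks → length ss ≢ length ks → carriedBinom c ss ks ≡ 0
carriedBinom-length c []       []       ≢ = contradiction refl ≢
carriedBinom-length c []       (_ ∷ _)  ≢ = refl
carriedBinom-length c (_ ∷ _)  []       ≢ = refl
carriedBinom-length c (s ∷ ss) (k ∷ ks) ≢ =
  trans (cong (((c ℕ.+ s) C k) ℕ.*_) (carriedBinom-length (c ℕ.+ s ∸ k) ss ks (≢ ∘ cong suc)))
        (ℕP.*-zeroʳ ((c ℕ.+ s) C k))

carriedBinom-heavy : ∀ c ss ks → c ℕ.+ sumℕ ss < sumℕ ks → carriedBinom c ss ks ≡ 0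
carriedBinom-heavy c []       []       c<0 = contradiction c<0 ℕP.n≮0
carriedBinom-heavy c []       (_ ∷ _)  _   = refl
carriedBinom-heavy c (_ ∷ _)  []       _   = refl
carriedBinom-heavy c (s ∷ ss) (k ∷ ks) heavy with k ℕP.≤? c ℕ.+ s
... | no  k≰c+s = cong (ℕ._* carriedBinom (c ℕ.+ s ∸ k) ss ks) (k>n⇒nCk≡0 (ℕP.≰⇒> k≰c+s))
... | yes k≤c+s =
  trans (cong (((c ℕ.+ s) C k) ℕ.*_) (carriedBinom-heavy (c ℕ.+ s ∸ k) ss ks still-heavy))
        (ℕP.*-zeroʳ ((c ℕ.+ s) C k))
  where
  open ℕP.≤-Reasoning
  still-heavy : c ℕ.+ s ∸ k ℕ.+ sumℕ ss < sumℕ ks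
  still-heavy = ℕP.+-cancelˡ-< k _ _ (begin-strict
    k ℕ.+ (c ℕ.+ s ∸ k ℕ.+ sumℕ ss) ≡⟨ sym (ℕP.+-assoc k _ _) ⟩
    k ℕ.+ (c ℕ.+ s ∸ k) ℕ.+ sumℕ ss ≡⟨ cong (ℕ._+ sumℕ ss) (ℕP.m+[n∸m]≡n k≤c+s) ⟩
    c ℕ.+ s ℕ.+ sumℕ ss             ≡⟨ ℕP.+-assoc c s _ ⟩
    c ℕ.+ (s ℕ.+ sumℕ ss)           <⟨ heavy ⟩
    k ℕ.+ sumℕ ks                   ∎)

carry-exponent : ∀ {j} a S r K → j ≤ a → a ∸ j ℕ.+ S ℕ.+ r ∸ K ≡ a ℕ.+ S ℕ.+ r ∸ (j ℕ.+ K)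
carry-exponent {j} a S r K j≤a = begin
  a ∸ j ℕ.+ S ℕ.+ r ∸ K
    ≡⟨ cong (λ x → x ℕ.+ r ∸ K) (sym (ℕP.+-∸-comm S j≤a)) ⟩
  a ℕ.+ S ∸ j ℕ.+ r ∸ K
    ≡⟨ cong (_∸ K) (sym (ℕP.+-∸-comm r (ℕP.≤-trans j≤a (ℕP.m≤m+n a S)))) ⟩
  a ℕ.+ S ℕ.+ r ∸ j ∸ K
    ≡⟨ ℕP.∸-+-assoc (a ℕ.+ S ℕ.+ r) j K ⟩
  a ℕ.+ S ℕ.+ r ∸ (j ℕ.+ K) ∎
  where open ≡-Reasoning

≡ᵇ-reflects-≡ : ∀ m n → Reflects (m ≡ n) (m ℕ.≡ᵇ n)
≡ᵇ-reflects-≡ m n = fromEquivalence (ℕP.≡ᵇ⇒≡ m n) (ℕP.≡⇒≡ᵇ m n)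

arrayBinom-on : ∀ ss s∞ ks k∞ → weight (ss , s∞) ≡ weight (ks , k∞) →
                arrayBinom (ss , s∞) (ks , k∞) ≡ carriedBinom 0 ss ks
arrayBinom-on ss s∞ ks k∞ w≡w
  with weight (ss , s∞) ℕ.≡ᵇ weight (ks , k∞) | ≡ᵇ-reflects-≡ (weight (ss , s∞)) (weight (ks , k∞))
... | true  | _      = binomGo≡carriedBinom ss ks 0 0
... | false | ofⁿ w≢w = contradiction w≡w w≢w

arrayBinom-off : ∀ ss s∞ ks k∞ → weight (ss , s∞) ≢ weight (ks , k∞) →
                 arrayBinom (ss , s∞) (ks , k∞) ≡ 0
arrayBinom-off ss s∞ ks k∞ w≢w
  with weight (ss , s∞) ℕ.≡ᵇ weight (ks , k∞) | ≡ᵇ-reflects-≡ (weight (ss , s∞)) (weight (ks , k∞))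
... | true  | ofʸ w≡w = contradiction w≡w w≢w
... | false | _      = refl

arrayBinom-vanish : ∀ ss s∞ ks k∞ → carriedBinom 0 ss ks ≡ 0 →
                    arrayBinom (ss , s∞) (ks , k∞) ≡ 0
arrayBinom-vanish ss s∞ ks k∞ cb≡0 =
  trans (cong (λ b → if weight (ss , s∞) ℕ.≡ᵇ weight (ks , k∞) then b else 0)
              (trans (binomGo≡carriedBinom ss ks 0 0) cb≡0))
        (if-eta (weight (ss , s∞) ℕ.≡ᵇ weight (ks , k∞)))

∑-arrayBinom-k∞ : ∀ s sr ks {W} → sumℕ s ℕ.+ sr ≤ W → (f : ℕ → ℤ) →
  ∑[ k∞ ∈ upTo (suc W) ] (+ arrayBinom (s , sr) (ks , k∞) * f k∞)
    ≡ + carriedBinom 0 s ks * f (sumℕ s ℕ.+ sr ∸ sumℕ ks)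
∑-arrayBinom-k∞ s sr ks {W} w≤W f with sumℕ ks ℕP.≤? sumℕ s
... | yes ks≤s = begin
  ∑[ i ∈ upTo (suc W) ] (+ arrayBinom (s , sr) (ks , i) * f i)
    ≡⟨ ∑-upTo-point _ (s≤s (ℕP.≤-trans (ℕP.m∸n≤m _ (sumℕ ks)) w≤W)) off ⟩
  + arrayBinom (s , sr) (ks , k∞) * f k∞
    ≡⟨ cong (λ b → + b * f k∞) (arrayBinom-on s sr ks k∞ (sym (ℕP.m+[n∸m]≡n ks≤w))) ⟩
  + carriedBinom 0 s ks * f k∞ ∎
  where
  open ≡-Reasoning
  k∞ : ℕ
  k∞ = sumℕ s ℕ.+ sr ∸ sumℕ ks
  ks≤w : sumℕ ks ≤ sumℕ s ℕ.+ sr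
  ks≤w = ℕP.≤-trans ks≤s (ℕP.m≤m+n (sumℕ s) sr)
  off : ∀ i → i ≢ k∞ → + arrayBinom (s , sr) (ks , i) * f i ≡ + 0
  off i i≢k∞ = cong (λ b → + b * f i) (arrayBinom-off s sr ks i
    (λ w≡w → i≢k∞ (sym (trans (cong (_∸ sumℕ ks) w≡w) (ℕP.m+n∸m≡n (sumℕ ks) i)))))
... | no ks≰s =
  trans (∑-zero (upTo (suc W)) (λ i → cong (λ b → + b * f i) (arrayBinom-vanish s sr ks i cb≡0)))
        (cong (λ b → + b * f (sumℕ s ℕ.+ sr ∸ sumℕ ks)) (sym cb≡0))
  where
  cb≡0 : carriedBinom 0 s ks ≡ 0
  cb≡0 = carriedBinom-heavy 0 s ks (ℕP.≰⇒> ks≰s)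

∑-box-suc : ∀ d W (f : List ℕ → ℤ) →
  ∑ (box (suc d) W) f ≡ ∑[ j ∈ upTo (suc W) ] ∑[ ks ∈ box d W ] f (j ∷ ks)
∑-box-suc d W f = trans (∑-concatMap (upTo (suc W)) (λ j → map (j ∷_) (box d W)) f)
                        (∑-cong (upTo (suc W)) (λ j → ∑-map (box d W) (j ∷_) f))

∑-box-zero : ∀ d W (f : List ℕ → ℤ) → (∀ ks → length ks ≡ d → f ks ≡ + 0) → ∑ (box d W) f ≡ + 0
∑-box-zero zero    W f f≗0 = cong (_+ + 0) (f≗0 [] refl)
∑-box-zero (suc d) W f f≗0 = trans (∑-box-suc d W f)
  (∑-zero (upTo (suc W)) (λ j → ∑-box-zero d W (f ∘ (j ∷_)) (λ ks len≡d → f≗0 (j ∷ ks) (cong suc len≡d))))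

∑-box-depth : ∀ {d₀ D} W (f : List ℕ → ℤ) → d₀ ≤ D → (∀ ks → length ks ≢ d₀ → f ks ≡ + 0) →
  ∑[ d ∈ upTo (suc D) ] ∑ (box d W) f ≡ ∑ (box d₀ W) f
∑-box-depth W f d₀≤D f≗0 = ∑-upTo-point _ (s≤s d₀≤D)
  (λ d d≢d₀ → ∑-box-zero d W f (λ ks len≡d → f≗0 ks (d≢d₀ ∘ trans (sym len≡d))))

∑-indicesUpTo : ∀ D W (F : Index → ℤ) →
  ∑ (indicesUpTo D W) F ≡ ∑[ d ∈ upTo (suc D) ] ∑[ ks ∈ box d W ] ∑[ k∞ ∈ upTo (suc W) ] F (ks , k∞)
∑-indicesUpTo D W F =
  trans (∑-concatMap (upTo (suc D)) indicesOfDepth F) (∑-cong (upTo (suc D)) λ d →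
    trans (∑-concatMap (box d W) (λ ks → map (ks ,_) (upTo (suc W))) F)
          (∑-cong (box d W) λ ks → ∑-map (upTo (suc W)) (ks ,_) F))
  where
  indicesOfDepth : ℕ → List Index
  indicesOfDepth d = concatMap (λ ks → map (ks ,_) (upTo (suc W))) (box d W)

-- The expansion

-- The exponent c + |ss| + sr − |ks| is the carry left after the last step; it becomes k∞.
expansionTerm : ℕ → List ℕ → ℕ → List ℕ → Seq
expansionTerm c ss sr ks n =
  + carriedBinom c ss ks * convPows ks (mulPow (c ℕ.+ sumℕ ss ℕ.+ sr ∸ sumℕ ks) (sumBelow δ₀)) n

expansionTerm-length : ∀ c ss sr ks n → length ss ≢ length ks → expansionTerm c ss sr ks n ≡ + 0
expansionTerm-length c ss sr ks n ≢ =
  cong (λ b → + b * convPows ks (mulPow (c ℕ.+ sumℕ ss ℕ.+ sr ∸ sumℕ ks) (sumBelow δ₀)) n)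
       (carriedBinom-length c ss ks ≢)

expansionTerm-cons : ∀ c s ss sr j ks n →
  expansionTerm c (s ∷ ss) sr (j ∷ ks) n
    ≡ + ((c ℕ.+ s) C j) * convPow j (expansionTerm (c ℕ.+ s ∸ j) ss sr ks) n
expansionTerm-cons c s ss sr j ks n = begin
  + (((c ℕ.+ s) C j) ℕ.* cb) * convPow j (term e) n
    ≡⟨ cong (_* convPow j (term e) n) (ℤP.pos-* ((c ℕ.+ s) C j) cb) ⟩
  + ((c ℕ.+ s) C j) * + cb * convPow j (term e) n
    ≡⟨ ℤP.*-assoc (+ ((c ℕ.+ s) C j)) (+ cb) _ ⟩
  + ((c ℕ.+ s) C j) * (+ cb * convPow j (term e) n)
    ≡⟨ C-guard (c ℕ.+ s) j (λ j≤c+s → cong (λ x → + cb * convPow j (term x) n) (sym (e′≡e j≤c+s))) ⟩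
  + ((c ℕ.+ s) C j) * (+ cb * convPow j (term e′) n)
    ≡⟨ cong (+ ((c ℕ.+ s) C j) *_) (sym (convPow-scalar j (+ cb) (term e′) n)) ⟩
  + ((c ℕ.+ s) C j) * convPow j (expansionTerm (c ℕ.+ s ∸ j) ss sr ks) n ∎
  where
  open ≡-Reasoning
  cb : ℕ
  cb = carriedBinom (c ℕ.+ s ∸ j) ss ks
  term : ℕ → Seq
  term x = convPows ks (mulPow x (sumBelow δ₀))
  e e′ : ℕ
  e = c ℕ.+ (s ℕ.+ sumℕ ss) ℕ.+ sr ∸ (j ℕ.+ sumℕ ks)
  e′ = c ℕ.+ s ∸ j ℕ.+ sumℕ ss ℕ.+ sr ∸ sumℕ ks
  e′≡e : j ≤ c ℕ.+ s → e′ ≡ e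
  e′≡e j≤c+s = trans (carry-exponent (c ℕ.+ s) (sumℕ ss) sr (sumℕ ks) j≤c+s)
                     (cong (λ x → x ℕ.+ sr ∸ (j ℕ.+ sumℕ ks)) (ℕP.+-assoc c s (sumℕ ss)))

expansion : ∀ c ss sr {W} → c ℕ.+ sumℕ ss ≤ W → ∀ n →
  mulPow c (liCoeff (ss ++ [ sr ])) n ≡ ∑[ ks ∈ box (length ss) W ] expansionTerm c ss sr ks n
expansion c [] sr {W} _ n = begin
  mulPow c (mulPow sr (sumBelow δ₀)) n
    ≡⟨ mulPow-+ c sr (sumBelow δ₀) n ⟩
  mulPow (c ℕ.+ sr) (sumBelow δ₀) n
    ≡⟨ cong (λ x → mulPow (x ℕ.+ sr) (sumBelow δ₀) n) (sym (ℕP.+-identityʳ c)) ⟩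
  mulPow (c ℕ.+ 0 ℕ.+ sr) (sumBelow δ₀) n
    ≡⟨ sym (ℤP.*-identityˡ _) ⟩
  expansionTerm c [] sr [] n
    ≡⟨ sym (ℤP.+-identityʳ _) ⟩
  ∑[ ks ∈ box 0 W ] expansionTerm c [] sr ks n ∎
  where open ≡-Reasoning
expansion c (s ∷ ss) sr {W} c+w≤W n = begin
  mulPow c (mulPow s (sumBelow L)) n
    ≡⟨ mulPow-+ c s (sumBelow L) n ⟩
  mulPow a (sumBelow L) n
    ≡⟨ mulPow-sumBelow (s≤s a≤W) L n ⟩
  ∑[ j ∈ upTo (suc W) ] (+ (a C j) * convPow j (mulPow (a ∸ j) L) n)
    ≡⟨ ∑-cong (upTo (suc W)) (λ j → cong (+ (a C j) *_) (convPow-cong j (expansion (a ∸ j) ss sr (bound j)) n)) ⟩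
  ∑[ j ∈ upTo (suc W) ] (+ (a C j) * convPow j (λ m → ∑[ ks ∈ box′ ] tail j ks m) n)
    ≡⟨ ∑-cong (upTo (suc W)) (λ j → cong (+ (a C j) *_) (convPow-∑ j box′ (tail j) n)) ⟩
  ∑[ j ∈ upTo (suc W) ] (+ (a C j) * ∑[ ks ∈ box′ ] convPow j (tail j ks) n)
    ≡⟨ ∑-cong (upTo (suc W)) (λ j → *-distribˡ-∑ (+ (a C j)) box′ _) ⟩
  ∑[ j ∈ upTo (suc W) ] ∑[ ks ∈ box′ ] (+ (a C j) * convPow j (tail j ks) n)
    ≡⟨ ∑-cong (upTo (suc W)) (λ j → ∑-cong box′ (λ ks → sym (expansionTerm-cons c s ss sr j ks n))) ⟩
  ∑[ j ∈ upTo (suc W) ] ∑[ ks ∈ box′ ] expansionTerm c (s ∷ ss) sr (j ∷ ks) n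
    ≡⟨ sym (∑-box-suc (length ss) W _) ⟩
  ∑[ ks ∈ box (length (s ∷ ss)) W ] expansionTerm c (s ∷ ss) sr ks n ∎
  where
  open ≡-Reasoning
  a : ℕ
  a = c ℕ.+ s
  L : Seq
  L = liCoeff (ss ++ [ sr ])
  box′ : List (List ℕ)
  box′ = box (length ss) W
  tail : ℕ → List ℕ → Seq
  tail j = expansionTerm (a ∸ j) ss sr
  a+w≤W : a ℕ.+ sumℕ ss ≤ W
  a+w≤W = subst (_≤ W) (sym (ℕP.+-assoc c s (sumℕ ss))) c+w≤W
  a≤W : a ≤ W
  a≤W = ℕP.≤-trans (ℕP.m≤m+n a (sumℕ ss)) a+w≤W
  bound : ∀ j → a ∸ j ℕ.+ sumℕ ss ≤ W
  bound j = ℕP.≤-trans (ℕP.+-monoˡ-≤ (sumℕ ss) (ℕP.m∸n≤m a j)) a+w≤W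

corollary5p4 : (s : List ℕ) (sᵣ : ℕ) (D W : ℕ) →
    length s ≤ D → weight (s , sᵣ) ≤ W → (n : ℕ) →
    liCoeff (s ++ [ sᵣ ]) n
      ≡ sumℤ (map (λ k → + arrayBinom (s , sᵣ) k * liPolyCoeff (M k · x₁) n)
                  (indicesUpTo D W))
corollary5p4 s sr D W len≤D w≤W n = begin
  liCoeff (s ++ [ sr ]) n
    ≡⟨ sym (ℤP.*-identityˡ _) ⟩
  mulPow 0 (liCoeff (s ++ [ sr ])) n
    ≡⟨ expansion 0 s sr (ℕP.≤-trans (ℕP.m≤m+n (sumℕ s) sr) w≤W) n ⟩
  ∑[ ks ∈ box (length s) W ] expansionTerm 0 s sr ks n
    ≡⟨ sym (∑-box-depth W _ len≤D (λ ks len≢ → expansionTerm-length 0 s sr ks n (len≢ ∘ sym))) ⟩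
  ∑[ d ∈ upTo (suc D) ] ∑[ ks ∈ box d W ] expansionTerm 0 s sr ks n
    ≡⟨ ∑-cong (upTo (suc D)) (λ d → ∑-cong (box d W) (λ ks → sym (select-k∞ ks))) ⟩
  ∑[ d ∈ upTo (suc D) ] ∑[ ks ∈ box d W ] ∑[ k∞ ∈ upTo (suc W) ] term (ks , k∞)
    ≡⟨ sym (∑-indicesUpTo D W term) ⟩
  ∑[ k ∈ indicesUpTo D W ] term k ∎
  where
  open ≡-Reasoning
  term : Index → ℤ
  term k = + arrayBinom (s , sr) k * liPolyCoeff (M k · x₁) n
  select-k∞ : ∀ ks → ∑[ k∞ ∈ upTo (suc W) ] term (ks , k∞) ≡ expansionTerm 0 s sr ks n
  select-k∞ ks =
    trans (∑-arrayBinom-k∞ s sr ks w≤W (λ k∞ → liPolyCoeff (M (ks , k∞) · x₁) n))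
          (cong (+ carriedBinom 0 s ks *_) (liPolyCoeff-M·x₁ ks (sumℕ s ℕ.+ sr ∸ sumℕ ks) n))
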